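{- Let $G$ be a finite simple graph with vertex set $V(G)=\{v_1,\dots,v_k,\dots,v_n\}$, where $1<k<n$. Suppose that (i) $\bigcup_{i=1}^{k}N[v_i]=V(G)$; (ii) $|d(v_i)-d(v_j)|>1$ for every $i\in\{1,\dots,k\}$ and every $j\in\{1,\dots,n\}\setminus\{i\}$; (iii) $N[v_1]\cap \bigcup_{i=2}^{k}N[v_i]=\emptyset$. Then $G$ is reconstructible.
   Context: Graphs are finite, simple and undirected. For a vertex $v$ of $G$, $d(v)$ denotes its degree, $N(v)=\{u\in V(G)\mid uv\in E(G)\}$ is its open neighborhood and $N[v]=N(v)\cup\{v\}$ its closed neighborhood. $G-v$ denotes the graph obtained by deleting the vertex $v$. A graph $G$ with $V(G)=\{v_1,\dots,v_n\}$ is called reconstructible if every graph $G'$ with $V(G')=\{v'_1,\dots,v'_n\}$ such that $G-v_j\cong G'-v'_j$ for all $j\in\{1,\dots,n\}$ is isomorphic to $G$. -}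

module Defs where

open import Data.Nat using (ℕ; suc; _<_; _≤_)
open import Data.Fin using (Fin; zero; punchIn; toℕ)
open import Data.Bool using (Bool; true; false; if_then_else_)
open import Data.List using (List; map)
open import Data.Nat.ListAction using (sum)
open import Data.List.Base using (allFin)
open import Data.Sum using (_⊎_)
open import Data.Product using (Σ)
open import Function.Bundles using (_↔_; Inverse)
open import Relation.Binary.PropositionalEquality using (_≡_)

-- A finite simple graph on the vertex set Fin n (vertex v_{i+1} is index i):
-- symmetric, irreflexive Boolean adjacency.
record Graph (n : ℕ) : Set where
  field
    adj   : Fin n → Fin n → Bool
    sym   : ∀ u v → adj u v ≡ adj v u
    irrefl : ∀ v → adj v v ≡ false
open Graph public

deg : ∀ {n} → Graph n → Fin n → ℕ
deg {n} G v = sum (map (λ u → if adj G v u then 1 else 0) (allFin n))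

InClosedNbhd : ∀ {n} → Graph n → Fin n → Fin n → Set
InClosedNbhd G v u = (u ≡ v) ⊎ (adj G v u ≡ true)

delete : ∀ {m} → Graph (suc m) → Fin (suc m) → Graph m
delete G v = record
  { adj = λ a b → adj G (punchIn v a) (punchIn v b)
  ; sym = λ a b → sym G (punchIn v a) (punchIn v b)
  ; irrefl = λ a → irrefl G (punchIn v a)
  }

_≅_ : ∀ {n} → Graph n → Graph n → Set
_≅_ {n} G H = Σ (Fin n ↔ Fin n) λ σ →
  ∀ a b → adj G a b ≡ adj H (Inverse.to σ a) (Inverse.to σ b)

Reconstructible : ∀ {m} → Graph (suc m) → Set
Reconstructible {m} G = ∀ (H : Graph (suc m)) → (∀ j → delete G j ≅ delete H j) → G ≅ H

-- The degree sequence is reconstructible once n ≥ 3: summing the degree sums of all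
-- cards counts every edge n − 2 times, so the deck determines the number of edges,
-- and then each card G − v determines d(v).  A vertex v_i (i ≤ k) whose degree
-- differs by at least 2 from every other degree is recognisable in every card
-- G − u: in a card isomorphism the image of v_i has degree within 1 of d(v_i),
-- hence is v_i itself, and comparing the two degrees shows that v_i ~ u in G iff
-- in G'.  So G and G' agree on all edges at v_1, …, v_k.  Extend an isomorphism
-- π : G − v_1 ≅ G' − v_1 by v_1 ↦ v_1.  It fixes v_2, …, v_k and preserves their
-- closed neighbourhoods, while (i) and (iii) say that w ≠ v_1 is adjacent to v_1
-- exactly when w lies in none of N[v_2], …, N[v_k].  Hence the extension is an
-- isomorphism G ≅ G'.
module Submission where

open import Defs
open import Data.Nat using (ℕ; suc; _<_; _≤_; ∣_-_∣)
open import Data.Fin using (Fin; zero; toℕ)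
open import Data.Product using (Σ; _×_)
open import Relation.Nullary using (¬_)
open import Relation.Binary.PropositionalEquality using (_≡_; _≢_)

open import Data.Bool using (Bool; true; false; if_then_else_)
open import Data.Fin using (suc; punchIn; punchOut; _≟_)
open import Data.Fin.Permutation using (lift₀)
open import Data.Fin.Properties using (punchIn-punchOut)
open import Data.List using (tabulate; map)
open import Data.List.Properties using (map-tabulate)
import Data.Nat.ListAction as List
open import Data.Nat using (zero; _+_; _*_; z≤n; s≤s)
open import Data.Nat.Properties
  using ( +-*-semiring; +-comm; +-cancelˡ-≡; +-cancelʳ-≡; *-cancelˡ-≡; *-distribʳ-+
        ; <-trans; <⇒≱; ≤-refl; ∣m+n-m+o∣≡∣n-o∣ )
open import Data.Nat.Tactic.RingSolver using (solve-∀)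
open import Algebra.Properties.Semiring.Sum +-*-semiring
  using (sum-syntax; sum-cong-≗; sum-remove; sum-permute; ∑-distrib-+; *-distribˡ-sum)
open import Data.Product using (_,_; proj₁; proj₂)
open import Data.Sum using (inj₁; inj₂)
open import Function using (_∘_)
open import Function.Bundles using (_↔_; Inverse; Injection; _⇔_; mk⇔; Equivalence)
open import Function.Properties.Inverse using (↔⇒↣)
open import Relation.Nullary using (yes; no)
open import Relation.Nullary.Decidable using (decidable-stable)
open import Relation.Nullary.Negation using (contradiction)
import Relation.Binary.PropositionalEquality as ≡
open import Relation.Binary.PropositionalEquality
  using (refl; trans; cong; cong₂; subst; _≗_; ≢-sym; module ≡-Reasoning)

open ≡-Reasoning

indicator : Bool → ℕ
indicator b = if b then 1 else 0

indicator-injective : ∀ {a b} → indicator a ≡ indicator b → a ≡ b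
indicator-injective {false} {false} _ = refl
indicator-injective {true}  {true}  _ = refl
indicator-injective {false} {true}  ()
indicator-injective {true}  {false} ()

∣indicator-indicator∣≤1 : ∀ a b → ∣ indicator a - indicator b ∣ ≤ 1
∣indicator-indicator∣≤1 false false = z≤n
∣indicator-indicator∣≤1 false true  = ≤-refl
∣indicator-indicator∣≤1 true  false = ≤-refl
∣indicator-indicator∣≤1 true  true  = z≤n

∑-const : ∀ n c → ∑[ i < n ] c ≡ n * c
∑-const zero    c = refl
∑-const (suc n) c = cong (c +_) (∑-const n c)

sum-tabulate : ∀ {n} (f : Fin n → ℕ) → List.sum (tabulate f) ≡ ∑[ i < n ] f i
sum-tabulate {zero}  f = refl
sum-tabulate {suc n} f = cong (f zero +_) (sum-tabulate (f ∘ suc))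

deg≡∑ : ∀ {n} (G : Graph n) v → deg G v ≡ ∑[ w < n ] indicator (adj G v w)
deg≡∑ G v = trans (cong List.sum (map-tabulate (λ w → w) (indicator ∘ adj G v)))
                  (sum-tabulate (indicator ∘ adj G v))

deg-punchIn : ∀ {m} (G : Graph (suc m)) u x →
  deg G (punchIn u x) ≡ deg (delete G u) x + indicator (adj G (punchIn u x) u)
deg-punchIn {m} G u x = begin
  deg G v                                         ≡⟨ deg≡∑ G v ⟩
  ∑[ w < suc m ] row w                            ≡⟨ sum-remove {i = u} row ⟩
  row u + ∑[ w < m ] row (punchIn u w)            ≡⟨ cong (row u +_) (deg≡∑ (delete G u) x) ⟨
  row u + deg (delete G u) x                      ≡⟨ +-comm (row u) _ ⟩
  deg (delete G u) x + row u                      ∎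
  where
  v = punchIn u x
  row : Fin (suc m) → ℕ
  row w = indicator (adj G v w)

deg-≅ : ∀ {n} (G H : Graph n) (φ : G ≅ H) a → deg G a ≡ deg H (Inverse.to (proj₁ φ) a)
deg-≅ {n} G H (σ , pres) a = begin
  deg G a                                         ≡⟨ deg≡∑ G a ⟩
  ∑[ w < n ] indicator (adj G a w)                ≡⟨ sum-cong-≗ (cong indicator ∘ pres a) ⟩
  ∑[ w < n ] row (to w)                           ≡⟨ sum-permute row σ ⟨
  ∑[ w < n ] row w                                ≡⟨ deg≡∑ H (to a) ⟨
  deg H (to a)                                    ∎
  where
  to = Inverse.to σ
  row : Fin n → ℕ
  row w = indicator (adj H (to a) w)

degreeSum : ∀ {n} → Graph n → ℕ
degreeSum {n} G = ∑[ v < n ] deg G v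

degreeSum-≅ : ∀ {n} (G H : Graph n) → G ≅ H → degreeSum G ≡ degreeSum H
degreeSum-≅ G H (σ , pres) =
  trans (sum-cong-≗ {x = deg G} {y = deg H ∘ Inverse.to σ} (deg-≅ G H (σ , pres)))
        (≡.sym (sum-permute (deg H) σ))

∑-adj-punchIn≡deg : ∀ {m} (G : Graph (suc m)) j →
  ∑[ x < m ] indicator (adj G (punchIn j x) j) ≡ deg G j
∑-adj-punchIn≡deg {m} G j = begin
  ∑[ x < m ] indicator (adj G (punchIn j x) j)
    ≡⟨ sum-cong-≗ {y = row ∘ punchIn j} (λ x → cong indicator (Graph.sym G _ j)) ⟩
  ∑[ x < m ] row (punchIn j x)
    ≡⟨ cong (λ b → indicator b + ∑[ x < m ] row (punchIn j x)) (Graph.irrefl G j) ⟨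
  row j + ∑[ x < m ] row (punchIn j x)
    ≡⟨ sum-remove {i = j} row ⟨
  ∑[ w < suc m ] row w
    ≡⟨ deg≡∑ G j ⟨
  deg G j ∎
  where
  row : Fin (suc m) → ℕ
  row w = indicator (adj G j w)

degreeSum-delete : ∀ {m} (G : Graph (suc m)) j →
  degreeSum G ≡ 2 * deg G j + degreeSum (delete G j)
degreeSum-delete {m} G j = begin
  degreeSum G
    ≡⟨ sum-remove {i = j} (deg G) ⟩
  deg G j + ∑[ x < m ] deg G (punchIn j x)
    ≡⟨ cong (deg G j +_) (sum-cong-≗ (deg-punchIn G j)) ⟩
  deg G j + ∑[ x < m ] (deg G-j x + column x)
    ≡⟨ cong (deg G j +_) (∑-distrib-+ (deg G-j) column) ⟩
  deg G j + (degreeSum G-j + ∑[ x < m ] column x)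
    ≡⟨ cong (λ d → deg G j + (degreeSum G-j + d)) (∑-adj-punchIn≡deg G j) ⟩
  deg G j + (degreeSum G-j + deg G j)
    ≡⟨ rearrange (deg G j) (degreeSum G-j) ⟩
  2 * deg G j + degreeSum G-j ∎
  where
  G-j = delete G j
  column : Fin m → ℕ
  column x = indicator (adj G (punchIn j x) j)
  rearrange : ∀ d s → d + (s + d) ≡ 2 * d + s
  rearrange = solve-∀

∑-degreeSum-delete : ∀ {p} (G : Graph (2 + p)) →
  ∑[ j < 2 + p ] degreeSum (delete G j) ≡ p * degreeSum G
∑-degreeSum-delete {p} G = +-cancelˡ-≡ (2 * S) _ _ (begin
  2 * S + ∑[ j < 2 + p ] degreeSum (delete G j)
    ≡⟨ cong (_+ ∑[ j < 2 + p ] degreeSum (delete G j)) (*-distribˡ-sum 2 (deg G)) ⟩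
  ∑[ j < 2 + p ] (2 * deg G j) + ∑[ j < 2 + p ] degreeSum (delete G j)
    ≡⟨ ∑-distrib-+ (λ j → 2 * deg G j) (λ j → degreeSum (delete G j)) ⟨
  ∑[ j < 2 + p ] (2 * deg G j + degreeSum (delete G j))
    ≡⟨ sum-cong-≗ {x = λ _ → S} (degreeSum-delete G) ⟨
  ∑[ j < 2 + p ] S
    ≡⟨ ∑-const (2 + p) S ⟩
  (2 + p) * S
    ≡⟨ *-distribʳ-+ S 2 p ⟩
  2 * S + p * S ∎)
  where S = degreeSum G

Hypomorphic : ∀ {m} → Graph (suc m) → Graph (suc m) → Set
Hypomorphic G H = ∀ j → delete G j ≅ delete H j

hypomorphic⇒degreeSum≡ : ∀ {q} (G H : Graph (3 + q)) → Hypomorphic G H → degreeSum G ≡ degreeSum H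
hypomorphic⇒degreeSum≡ {q} G H deck = *-cancelˡ-≡ _ _ (suc q) (begin
  suc q * degreeSum G                        ≡⟨ ∑-degreeSum-delete G ⟨
  ∑[ j < 3 + q ] degreeSum (delete G j)      ≡⟨ sum-cong-≗ {y = degreeSum ∘ delete H} cards≡ ⟩
  ∑[ j < 3 + q ] degreeSum (delete H j)      ≡⟨ ∑-degreeSum-delete H ⟩
  suc q * degreeSum H                        ∎)
  where
  cards≡ : ∀ j → degreeSum (delete G j) ≡ degreeSum (delete H j)
  cards≡ j = degreeSum-≅ (delete G j) (delete H j) (deck j)

hypomorphic⇒deg≗ : ∀ {q} (G H : Graph (3 + q)) → Hypomorphic G H → deg G ≗ deg H
hypomorphic⇒deg≗ G H deck j = *-cancelˡ-≡ _ _ 2 (+-cancelʳ-≡ (degreeSum (delete G j)) _ _ (begin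
  2 * deg G j + degreeSum (delete G j)
    ≡⟨ degreeSum-delete G j ⟨
  degreeSum G
    ≡⟨ hypomorphic⇒degreeSum≡ G H deck ⟩
  degreeSum H
    ≡⟨ degreeSum-delete H j ⟩
  2 * deg H j + degreeSum (delete H j)
    ≡⟨ cong (2 * deg H j +_) (degreeSum-≅ (delete G j) (delete H j) (deck j)) ⟨
  2 * deg H j + degreeSum (delete G j) ∎))

DegreeIsolated : ∀ {n} → Graph n → Fin n → Set
DegreeIsolated G i = ∀ j → i ≢ j → 1 < ∣ deg G i - deg G j ∣

module _ {m} (G H : Graph (suc m)) (deg≗ : deg G ≗ deg H) (u : Fin (suc m))
         (φ : delete G u ≅ delete H u) (x : Fin m) where

  private
    y : Fin m
    y = Inverse.to (proj₁ φ) x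

    i t : Fin (suc m)
    i = punchIn u x
    t = punchIn u y

    c : ℕ
    c = deg (delete G u) x

    deg-i : deg G i ≡ c + indicator (adj G i u)
    deg-i = deg-punchIn G u x

    deg-t : deg G t ≡ c + indicator (adj H t u)
    deg-t = begin
      deg G t
        ≡⟨ deg≗ t ⟩
      deg H t
        ≡⟨ deg-punchIn H u y ⟩
      deg (delete H u) y + indicator (adj H t u)
        ≡⟨ cong (_+ indicator (adj H t u)) (deg-≅ (delete G u) (delete H u) φ x) ⟨
      c + indicator (adj H t u) ∎

    ∣deg-i-deg-t∣≤1 : ∣ deg G i - deg G t ∣ ≤ 1
    ∣deg-i-deg-t∣≤1 = subst (_≤ 1)
      (≡.sym (trans (cong₂ ∣_-_∣ deg-i deg-t) (∣m+n-m+o∣≡∣n-o∣ c _ _)))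
      (∣indicator-indicator∣≤1 (adj G i u) (adj H t u))

  card-iso-fixes-isolated : DegreeIsolated G (punchIn u x) →
    punchIn u (Inverse.to (proj₁ φ) x) ≡ punchIn u x
  card-iso-fixes-isolated isolated = decidable-stable (t ≟ i) λ t≢i →
    <⇒≱ (isolated t (≢-sym t≢i)) ∣deg-i-deg-t∣≤1

  card-adj-isolated : DegreeIsolated G (punchIn u x) →
    adj G (punchIn u x) u ≡ adj H (punchIn u x) u
  card-adj-isolated isolated = indicator-injective (+-cancelˡ-≡ c _ _ (begin
    c + indicator (adj G i u) ≡⟨ deg-i ⟨
    deg G i                   ≡⟨ cong (deg G) t≡i ⟨
    deg G t                   ≡⟨ deg-t ⟩
    c + indicator (adj H t u) ≡⟨ cong (λ v → c + indicator (adj H v u)) t≡i ⟩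
    c + indicator (adj H i u) ∎))
    where t≡i = card-iso-fixes-isolated isolated

adj-isolated : ∀ {m} (G H : Graph (suc m)) → Hypomorphic G H → deg G ≗ deg H →
  ∀ {i} → DegreeIsolated G i → adj G i ≗ adj H i
adj-isolated G H deck deg≗ {i} isolated w with w ≟ i
... | yes refl = trans (Graph.irrefl G w) (≡.sym (Graph.irrefl H w))
... | no w≢i = subst (λ v → adj G v w ≡ adj H v w) (punchIn-punchOut w≢i)
  (card-adj-isolated G H deg≗ w (deck w) (punchOut w≢i)
    (subst (DegreeIsolated G) (≡.sym (punchIn-punchOut w≢i)) isolated))

CoveredByOthers : ∀ {n} → ℕ → Graph n → Fin n → Set
CoveredByOthers k G w = Σ _ λ i → 1 ≤ toℕ i × toℕ i < k × InClosedNbhd G i w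

module _ {m k} (G : Graph (suc m))
  (cover : ∀ u → Σ (Fin (suc m)) λ i → toℕ i < k × InClosedNbhd G i u)
  (disjoint : ∀ i u → 1 ≤ toℕ i → toℕ i < k → InClosedNbhd G zero u → ¬ InClosedNbhd G i u) where

  nonadjacent⇒covered : ∀ {w} → w ≢ zero → adj G zero w ≡ false → CoveredByOthers k G w
  nonadjacent⇒covered {w} w≢0 ¬a with cover w
  ... | zero  , _   , inj₁ w≡0 = contradiction w≡0 w≢0
  ... | zero  , _   , inj₂ a   = contradiction (trans (≡.sym a) ¬a) λ ()
  ... | suc i , i<k , w∈N[i]   = suc i , s≤s z≤n , i<k , w∈N[i]

  adjacent⇒uncovered : ∀ {w} → adj G zero w ≡ true → ¬ CoveredByOthers k G w
  adjacent⇒uncovered a (i , 1≤i , i<k , w∈N[i]) = disjoint i _ 1≤i i<k (inj₂ a) w∈N[i]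

  adj-zero-cong : ∀ {w w′} → w ≢ zero → w′ ≢ zero →
    CoveredByOthers k G w ⇔ CoveredByOthers k G w′ → adj G zero w ≡ adj G zero w′
  adj-zero-cong {w} {w′} w≢0 w′≢0 w⇔w′ with adj G zero w in a | adj G zero w′ in a′
  ... | true  | true  = refl
  ... | false | false = refl
  ... | true  | false =
    contradiction (Equivalence.from w⇔w′ (nonadjacent⇒covered w′≢0 a′)) (adjacent⇒uncovered a)
  ... | false | true  =
    contradiction (Equivalence.to w⇔w′ (nonadjacent⇒covered w≢0 a)) (adjacent⇒uncovered a′)

module _ {m k} (G H : Graph (suc m)) (deck : Hypomorphic G H) (deg≗ : deg G ≗ deg H)
  (isolated : ∀ i → toℕ i < k → DegreeIsolated G i) where

  private
    σ : Fin (suc m) ↔ Fin (suc m)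
    σ = lift₀ (proj₁ (deck zero))

    σ-fixes-others : ∀ i → toℕ (suc i) < k → Inverse.to σ (suc i) ≡ suc i
    σ-fixes-others i i<k =
      card-iso-fixes-isolated G H deg≗ zero (deck zero) i (isolated (suc i) i<k)

    adj-others-σ : ∀ i w → toℕ (suc i) < k → adj G (suc i) (Inverse.to σ w) ≡ adj G (suc i) w
    adj-others-σ i zero    _   = refl
    adj-others-σ i (suc y) i<k = begin
      adj G (suc i) (to (suc y))       ≡⟨ adj-isolated G H deck deg≗ (isolated (suc i) i<k) _ ⟩
      adj H (suc i) (to (suc y))       ≡⟨ cong (λ v → adj H v (to (suc y))) (σ-fixes-others i i<k) ⟨
      adj H (to (suc i)) (to (suc y))  ≡⟨ proj₂ (deck zero) i y ⟨
      adj G (suc i) (suc y)            ∎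
      where to = Inverse.to σ

    nbhd-others-σ : ∀ i w → 1 ≤ toℕ i → toℕ i < k →
      InClosedNbhd G i w ⇔ InClosedNbhd G i (Inverse.to σ w)
    nbhd-others-σ (suc i) w _ i<k = mk⇔ forth back
      where
      to = Inverse.to σ
      forth : InClosedNbhd G (suc i) w → InClosedNbhd G (suc i) (to w)
      forth (inj₁ w≡i) = inj₁ (trans (cong to w≡i) (σ-fixes-others i i<k))
      forth (inj₂ a)   = inj₂ (trans (adj-others-σ i w i<k) a)
      back : InClosedNbhd G (suc i) (to w) → InClosedNbhd G (suc i) w
      back (inj₁ σw≡i) =
        inj₁ (Injection.injective (↔⇒↣ σ) (trans σw≡i (≡.sym (σ-fixes-others i i<k))))
      back (inj₂ a)    = inj₂ (trans (≡.sym (adj-others-σ i w i<k)) a)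

    covered-σ : ∀ w → CoveredByOthers k G w ⇔ CoveredByOthers k G (Inverse.to σ w)
    covered-σ w = mk⇔
      (λ (i , 1≤i , i<k , c) → i , 1≤i , i<k , Equivalence.to (nbhd-others-σ i w 1≤i i<k) c)
      (λ (i , 1≤i , i<k , c) → i , 1≤i , i<k , Equivalence.from (nbhd-others-σ i w 1≤i i<k) c)

  hypomorphic⇒≅ : 0 < k →
    (∀ u → Σ (Fin (suc m)) λ i → toℕ i < k × InClosedNbhd G i u) →
    (∀ i u → 1 ≤ toℕ i → toℕ i < k → InClosedNbhd G zero u → ¬ InClosedNbhd G i u) →
    G ≅ H
  hypomorphic⇒≅ 0<k cover disjoint = σ , preserves
    where
    to = Inverse.to σ
    preserves : ∀ a b → adj G a b ≡ adj H (to a) (to b)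
    preserves zero zero       = trans (Graph.irrefl G zero) (≡.sym (Graph.irrefl H zero))
    preserves zero (suc y)    = begin
      adj G zero (suc y)       ≡⟨ adj-zero-cong G cover disjoint (λ ()) (λ ()) (covered-σ (suc y)) ⟩
      adj G zero (to (suc y))  ≡⟨ adj-isolated G H deck deg≗ (isolated zero 0<k) _ ⟩
      adj H zero (to (suc y))  ∎
    preserves (suc x) zero    =
      trans (Graph.sym G (suc x) zero) (trans (preserves zero (suc x)) (Graph.sym H zero (to (suc x))))
    preserves (suc x) (suc y) = proj₂ (deck zero) x y

mainTheorem1 : (m k : ℕ) → 1 < k → k < suc m → (G : Graph (suc m)) →
    (∀ u → Σ (Fin (suc m)) λ i → toℕ i < k × InClosedNbhd G i u) →
    (∀ i j → toℕ i < k → i ≢ j → 1 < ∣ deg G i - deg G j ∣) →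
    (∀ i u → 1 ≤ toℕ i → toℕ i < k → InClosedNbhd G zero u → ¬ InClosedNbhd G i u) →
    Reconstructible G
mainTheorem1 zero          k (s≤s (s≤s _)) (s≤s ())       G cover isolated disjoint H deck
mainTheorem1 (suc zero)    k (s≤s (s≤s _)) (s≤s (s≤s ())) G cover isolated disjoint H deck
mainTheorem1 (suc (suc q)) k 1<k           _              G cover isolated disjoint H deck =
  hypomorphic⇒≅ G H deck (hypomorphic⇒deg≗ G H deck) (λ i i<k j → isolated i j i<k)
    (<-trans (s≤s z≤n) 1<k) cover disjoint
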